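{- Let $a$ be a positive integer and let $k,l\in\mathbb{Z}$ with $k\equiv l\pmod{3^a}$. Then $$2k^2-k\left(\frac{k}{3}\right)\equiv 2l^2-l\left(\frac{l}{3}\right)\pmod{3^{a+1}}.$$
   Context: $\left(\frac{k}{3}\right)$ is the Legendre symbol modulo 3: it equals $0$ if $3\mid k$, $1$ if $k\equiv1\pmod 3$, and $-1$ if $k\equiv 2\pmod 3$. -}

module Defs where

open import Data.Nat as ℕ using (ℕ; zero; suc)
open import Data.Integer using (ℤ; +_; -_; 0ℤ; 1ℤ; -1ℤ; _-_; _*_)
open import Data.Integer.DivMod using (_%ℕ_)
import Data.Integer.Divisibility as ℤ∣

legendre3-aux : ℕ → ℤ
legendre3-aux 0 = 0ℤ
legendre3-aux 1 = 1ℤ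
legendre3-aux _ = -1ℤ

legendre3 : ℤ → ℤ
legendre3 k = legendre3-aux (k %ℕ 3)

_≡_[mod_] : ℤ → ℤ → ℕ → Set
x ≡ y [mod m ] = ℤ∣._∣_ (+ m) (x - y)

module Submission where

-- Write ε(k) for the Legendre symbol (k/3) and f(k) = 2k² − k·ε(k).
-- Two elementary facts about ε drive the argument:
--   (1) k ≡ ε(k) (mod 3), since ε(k) ∈ {0, 1, −1} is the residue of k mod 3;
--   (2) hence ε(k) only depends on k mod 3: if k ≡ l (mod 3) then ε(k) ≡ ε(l)
--       (mod 3), and two distinct values in {0, 1, −1} are never congruent.
-- Now let 3^a ∣ k − l with a ≥ 1.  Then 3 ∣ k − l, so ε(k) = ε(l) =: e, and
--   f(k) − f(l) = (2(k + l) − e)·(k − l).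
-- By (1), 2(k + l) − e = 2(k − e) + 2(l − e) + 3e is divisible by 3, so the
-- product is divisible by 3·3^a = 3^(a+1).

open import Defs
open import Data.Nat using (ℕ; suc; _^_; NonZero)
open import Data.Integer using (ℤ; +_; _-_; _*_)
import Data.Nat as ℕ
import Data.Nat.Divisibility as ℕ∣
open import Data.Integer using (_+_; 0ℤ; 1ℤ)
open import Data.Integer.DivMod using (_%ℕ_; _/ℕ_; n%ℕd<d; a≡a%ℕn+[a/ℕn]*n)
open import Data.Integer.Properties using (abs-*)
import Data.Integer.Divisibility as ℤ∣
open import Data.Integer.Divisibility.Signed
  using (_∣_; divides; ∣-refl; ∣-trans; ∣ᵤ⇒∣; ∣⇒∣ᵤ; ∣m∣n⇒∣m+n; ∣m∣n⇒∣m-n; ∣n⇒∣m*n)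
open import Data.Integer.Solver using (module +-*-Solver)
open +-*-Solver using (solve; _:+_; _:-_; _:*_; _:=_; con)
open import Relation.Binary.PropositionalEquality using (_≡_; refl; sym; cong; subst; module ≡-Reasoning)
open import Data.Empty using (⊥-elim)

*-pres-∣ᵤ : ∀ m n x y → + m ℤ∣.∣ x → + n ℤ∣.∣ y → + (m ℕ.* n) ℤ∣.∣ (x * y)
*-pres-∣ᵤ m n x y m∣x n∣y =
  subst (m ℕ.* n ℕ∣.∣_) (sym (abs-* x y)) (ℕ∣.*-pres-∣ m∣x n∣y)

residue≡legendre3-aux : ∀ r → r ℕ.< 3 → + 3 ∣ (+ r - legendre3-aux r)
residue≡legendre3-aux 0 _ = divides 0ℤ refl
residue≡legendre3-aux 1 _ = divides 0ℤ refl
residue≡legendre3-aux 2 _ = divides 1ℤ refl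
residue≡legendre3-aux (suc (suc (suc _))) (ℕ.s≤s (ℕ.s≤s (ℕ.s≤s ())))

-- Fact (1): every integer is congruent to its Legendre symbol modulo 3.
-- Write k = r + 3q with r = k mod 3; then k − ε(k) = (r − ε(r)) + 3q.
k≡legendre3 : ∀ k → + 3 ∣ (k - legendre3 k)
k≡legendre3 k =
  subst (+ 3 ∣_) (sym split)
    (∣m∣n⇒∣m+n (residue≡legendre3-aux r (n%ℕd<d k 3)) (∣n⇒∣m*n q (∣-refl {+ 3})))
  where
  r = k %ℕ 3
  q = k /ℕ 3
  split : k - legendre3 k ≡ (+ r - legendre3 k) + q * + 3
  split = begin
    k - legendre3 k                      ≡⟨ cong (_- legendre3 k) (a≡a%ℕn+[a/ℕn]*n k 3) ⟩
    (+ r + q * + 3) - legendre3 k        ≡⟨ solve 3 (λ r q e → (r :+ q :* con (+ 3)) :- e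
                                                          := (r :- e) :+ q :* con (+ 3))
                                              refl (+ r) q (legendre3 k) ⟩
    (+ r - legendre3 k) + q * + 3        ∎
    where open ≡-Reasoning

-- 3 divides neither 1 nor 2, the possible sizes of a difference of two distinct
-- values among 0, 1, −1.
3∤1 : 3 ℕ∣.∤ 1
3∤1 = ℕ∣.>⇒∤ (ℕ.s≤s (ℕ.s≤s ℕ.z≤n))

3∤2 : 3 ℕ∣.∤ 2
3∤2 = ℕ∣.>⇒∤ (ℕ.s≤s (ℕ.s≤s (ℕ.s≤s ℕ.z≤n)))

legendre3-aux-mod3-injective : ∀ r s →
  + 3 ∣ (legendre3-aux r - legendre3-aux s) → legendre3-aux r ≡ legendre3-aux s
legendre3-aux-mod3-injective 0 0 _ = refl
legendre3-aux-mod3-injective 1 1 _ = refl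
legendre3-aux-mod3-injective (suc (suc _)) (suc (suc _)) _ = refl
legendre3-aux-mod3-injective 0 1 3∣ = ⊥-elim (3∤1 (∣⇒∣ᵤ 3∣))
legendre3-aux-mod3-injective 0 (suc (suc _)) 3∣ = ⊥-elim (3∤1 (∣⇒∣ᵤ 3∣))
legendre3-aux-mod3-injective 1 0 3∣ = ⊥-elim (3∤1 (∣⇒∣ᵤ 3∣))
legendre3-aux-mod3-injective 1 (suc (suc _)) 3∣ = ⊥-elim (3∤2 (∣⇒∣ᵤ 3∣))
legendre3-aux-mod3-injective (suc (suc _)) 0 3∣ = ⊥-elim (3∤1 (∣⇒∣ᵤ 3∣))
legendre3-aux-mod3-injective (suc (suc _)) 1 3∣ = ⊥-elim (3∤2 (∣⇒∣ᵤ 3∣))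

-- Fact (2): the Legendre symbol is constant on residue classes mod 3, because
-- ε(k) − ε(l) = (k − l) − (k − ε(k)) + (l − ε(l)) is divisible by 3.
legendre3-mod3 : ∀ k l → + 3 ∣ (k - l) → legendre3 k ≡ legendre3 l
legendre3-mod3 k l 3∣k-l =
  legendre3-aux-mod3-injective (k %ℕ 3) (l %ℕ 3)
    (subst (+ 3 ∣_) (sym rearrange)
      (∣m∣n⇒∣m+n (∣m∣n⇒∣m-n 3∣k-l (k≡legendre3 k)) (k≡legendre3 l)))
  where
  rearrange : legendre3 k - legendre3 l
            ≡ ((k - l) - (k - legendre3 k)) + (l - legendre3 l)
  rearrange = solve 4 (λ k l e d → e :- d := ((k :- l) :- (k :- e)) :+ (l :- d))
    refl k l (legendre3 k) (legendre3 l)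

-- If k ≡ e and l ≡ e (mod 3) then 3 ∣ 2(k + l) − e,
-- since 2(k + l) − e = 2(k − e) + 2(l − e) + 3e.
doubled-sum-mod3 : ∀ k l e → + 3 ∣ (k - e) → + 3 ∣ (l - e) →
  + 3 ∣ (+ 2 * (k + l) - e)
doubled-sum-mod3 k l e 3∣k-e 3∣l-e =
  subst (+ 3 ∣_) (sym rearrange)
    (∣m∣n⇒∣m+n (∣m∣n⇒∣m+n (∣n⇒∣m*n (+ 2) 3∣k-e) (∣n⇒∣m*n (+ 2) 3∣l-e))
               (∣n⇒∣m*n e (∣-refl {+ 3})))
  where
  rearrange : + 2 * (k + l) - e ≡ (+ 2 * (k - e) + + 2 * (l - e)) + e * + 3
  rearrange = solve 3
    (λ k l e → con (+ 2) :* (k :+ l) :- e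
             := (con (+ 2) :* (k :- e) :+ con (+ 2) :* (l :- e)) :+ e :* con (+ 3))
    refl k l e

difference-factorisation : ∀ k l e →
  (+ 2 * (k * k) - k * e) - (+ 2 * (l * l) - l * e) ≡ (+ 2 * (k + l) - e) * (k - l)
difference-factorisation = solve 3
  (λ k l e → (con (+ 2) :* (k :* k) :- k :* e) :- (con (+ 2) :* (l :* l) :- l :* e)
           := (con (+ 2) :* (k :+ l) :- e) :* (k :- l))
  refl

lemma3p1 : (a : ℕ) → .{{_ : NonZero a}} → (k l : ℤ) → k ≡ l [mod 3 ^ a ] →
    (+ 2 * (k * k) - k * legendre3 k) ≡ (+ 2 * (l * l) - l * legendre3 l) [mod 3 ^ suc a ]
lemma3p1 a@(suc b) k l 3^a∣k-l =
  subst (+ (3 ^ suc a) ℤ∣.∣_) (sym factorised)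
    (*-pres-∣ᵤ 3 (3 ^ a) (+ 2 * (k + l) - e) (k - l) (∣⇒∣ᵤ 3∣doubled-sum) 3^a∣k-l)
  where
  -- a ≥ 1, so in particular k ≡ l (mod 3) and both have the same symbol e
  3∣k-l : + 3 ∣ (k - l)
  3∣k-l = ∣-trans {j = + (3 ^ a)} (∣ᵤ⇒∣ (ℕ∣.m∣m*n (3 ^ b))) (∣ᵤ⇒∣ 3^a∣k-l)
  e : ℤ
  e = legendre3 k
  same-symbol : legendre3 l ≡ e
  same-symbol = sym (legendre3-mod3 k l 3∣k-l)
  3∣doubled-sum : + 3 ∣ (+ 2 * (k + l) - e)
  3∣doubled-sum = doubled-sum-mod3 k l e (k≡legendre3 k)
    (subst (λ d → + 3 ∣ (l - d)) same-symbol (k≡legendre3 l))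
  factorised : (+ 2 * (k * k) - k * e) - (+ 2 * (l * l) - l * legendre3 l)
             ≡ (+ 2 * (k + l) - e) * (k - l)
  factorised rewrite same-symbol = difference-factorisation k l e
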